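{- The containment relation $\ge$ is a partial order on the set $[\mathrm{Cay}]$ of equivalence classes of Cayley permutations.
   Context: A Cayley permutation of length $n\ge0$ is a word $x=x(1)\cdots x(n)$ of positive integers in which every integer from $1$ to $\max(x)$ occurs; $\mathrm{id}_n=12\cdots n$. $x$ contains $y$ ($x\ge y$) if some subsequence $x(i_1)\cdots x(i_k)$, $i_1<\cdots<i_k$, is order isomorphic to $y$ (same relative order and same equalities among entries). For a weakly increasing Cayley permutation $u$ and a Cayley permutation $v$ of the same length, the Burge transpose $(u,v)^T$ of the biword with columns $\binom{u(i)}{v(i)}$ is obtained by flipping each column and sorting the columns increasingly by top entry, ties broken by decreasing bottom entry. For $x$ of length $n$, $\gamma(x)$ is the bottom row of $(\mathrm{id}_n,x)^T$. Define $x\sim y$ iff $\gamma(x)=\gamma(y)$; $[x]$ is the class of $x$ and $[\mathrm{Cay}]$ the set of classes. For classes, $[x]\ge[y]$ iff $x'\ge y'$ for some $x'\in[x]$ and $y'\in[y]$. -}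

module Defs where

open import Data.Nat using (ℕ; zero; suc; _<_; _≤_; _⊔_; _<ᵇ_; _≡ᵇ_; _≤ᵇ_)
open import Data.Bool using (Bool; true; false; _∨_; _∧_; if_then_else_)
open import Data.List using (List; []; _∷_; map; zip; length; upTo; foldr; lookup)
open import Data.List.Membership.Propositional using (_∈_)
open import Data.List.Relation.Unary.All using (All)
open import Data.List.Relation.Binary.Sublist.Propositional using (_⊆_)
open import Data.Product using (Σ; ∃; ∃-syntax; _×_; _,_; proj₁; proj₂; swap)
open import Data.Fin using (Fin; cast)
open import Function.Bundles using (_⇔_)
open import Relation.Binary.PropositionalEquality using (_≡_)

Word : Set
Word = List ℕ

maxW : Word → ℕ
maxW = foldr _⊔_ 0

IsCayley : Word → Set
IsCayley x = All (λ a → 1 ≤ a) x × (∀ k → 1 ≤ k → k ≤ maxW x → k ∈ x)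

Cay : Set
Cay = Σ Word IsCayley

idW : ℕ → Word
idW n = map suc (upTo n)

OrderIso : Word → Word → Set
OrderIso a b = Σ (length a ≡ length b) λ eq → ∀ (i j : Fin (length a)) →
  ((lookup a i < lookup a j) ⇔ (lookup b (cast eq i) < lookup b (cast eq j))) ×
  ((lookup a i ≡ lookup a j) ⇔ (lookup b (cast eq i) ≡ lookup b (cast eq j)))

Contains : Word → Word → Set
Contains x y = ∃[ z ] (z ⊆ x × OrderIso z y)

-- Biwords as lists of columns (top , bottom).
Column : Set
Column = ℕ × ℕ

beforeᵇ : Column → Column → Bool
beforeᵇ (a , b) (c , d) = (a <ᵇ c) ∨ ((a ≡ᵇ c) ∧ (d ≤ᵇ b))

insertCol : Column → List Column → List Column
insertCol p [] = p ∷ []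
insertCol p (q ∷ qs) = if beforeᵇ p q then p ∷ q ∷ qs else q ∷ insertCol p qs

sortCols : List Column → List Column
sortCols [] = []
sortCols (p ∷ ps) = insertCol p (sortCols ps)

burgeT : List Column → List Column
burgeT w = sortCols (map swap w)

biword : Word → Word → List Column
biword u v = zip u v

γ : Word → Word
γ x = map proj₂ (burgeT (biword (idW (length x)) x))

_∼_ : Cay → Cay → Set
x ∼ y = γ (proj₁ x) ≡ γ (proj₁ y)

_≥ᶜ_ : Cay → Cay → Set
x ≥ᶜ y = ∃[ x' ] ∃[ y' ] (x' ∼ x × y' ∼ y × Contains (proj₁ x') (proj₁ y'))

module Submission where

-- Insertion sort places the column (x(i), i) before a column (x(j), j) with j > i exactly when
-- x(i) < x(j).  Hence γ x ≡ γ y precisely when x and y have the same length and, for all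
-- positions i < j, x(i) < x(j) iff y(i) < y(j) (SameRises).  Order isomorphism implies this
-- relation, and it passes to the subsequences of x and y taken at common positions.  So if
-- x ≥ y, y ∼ y' and y' ≥ z, the occurrence of z in y' can be moved to y and then into x,
-- giving a subsequence of x with γ-value γ z, which standardisation turns into a Cayley
-- permutation.  As γ preserves length, mutual containment of classes forces the occurrence
-- to be the whole word, whence antisymmetry.

open import Defs
open import Relation.Binary.Structures using (IsPartialOrder)
open import Data.Nat using (ℕ; zero; suc; _<_; _≤_; _≤′_; ≤′-refl; ≤′-step; _<ᵇ_; _≡ᵇ_; _≤ᵇ_; _+_; z≤n; s≤s; _<?_)
open import Data.Nat.Properties
open import Data.Bool using (true; false; _∨_; _∧_; T)
open import Data.Bool.Properties using (T-≡; T-∨; T-∧; ∧-zeroʳ; ∨-identityʳ)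
open import Data.Unit using (tt)
open import Data.Fin as Fin using (Fin; cast)
open import Data.List using (List; []; _∷_; map; zip; length; lookup; _++_; applyUpTo)
open import Data.List.Properties using (∷-injective; map-++; map-applyUpTo; length-map)
open import Data.List.Membership.Propositional using (_∈_; _∉_)
open import Data.List.Membership.Propositional.Properties using (∈-map⁻; ∈-map⁺; ∈-++⁻; ∈-++⁺ˡ; ∈-++⁺ʳ)
open import Data.List.Membership.DecPropositional _≟_ using (_∈?_)
open import Data.List.Relation.Unary.Any using (here; there)
open import Data.List.Relation.Unary.All as All using (All; []; _∷_)
open import Data.List.Relation.Unary.AllPairs as AllPairs using (AllPairs; []; _∷_)
open import Data.List.Relation.Binary.Sublist.Propositional as Sublist using (_⊆_; []; _∷_; _∷ʳ_; ⊆-refl; ⊆-trans)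
open import Data.List.Relation.Binary.Sublist.Propositional.Properties using (All-resp-⊆; length-mono-≤; to-≋)
open import Data.List.Relation.Binary.Equality.Propositional using (≋⇒≡)
open import Data.List.Relation.Binary.Permutation.Propositional using (_↭_; ↭-refl; ↭-prep; ↭-swap; ↭-trans; ↭-sym)
open import Data.List.Relation.Binary.Permutation.Propositional.Properties using (∈-resp-↭; All-resp-↭; ↭-length)
open import Data.Product using (∃-syntax; _×_; _,_; proj₁; proj₂; swap)
open import Data.Sum using (_⊎_; inj₁; inj₂)
open import Data.Empty using (⊥-elim)
open import Function using (_∘_; id; const)
open import Function.Bundles using (_⇔_; mk⇔; Equivalence)
open import Function.Construct.Identity using (⇔-id)
open import Function.Construct.Symmetry using (⇔-sym)
open import Relation.Binary.PropositionalEquality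
open import Relation.Nullary using (¬_; yes; no; contradiction)
open import Relation.Binary.Definitions using (tri<; tri≈; tri>)

open Equivalence using (to; from)

¬T⇒≡false : ∀ {b} → ¬ T b → b ≡ false
¬T⇒≡false {false} _  = refl
¬T⇒≡false {true}  ¬t = ⊥-elim (¬t tt)

T-⇔⇒≡ : ∀ {b c} → T b ⇔ T c → b ≡ c
T-⇔⇒≡ {false} {false} _ = refl
T-⇔⇒≡ {false} {true}  h = ⊥-elim (from h tt)
T-⇔⇒≡ {true}  {false} h = ⊥-elim (to h tt)
T-⇔⇒≡ {true}  {true}  _ = refl

<ᵇ-cong : ∀ {a b c d} → (a < b ⇔ c < d) → (a <ᵇ b) ≡ (c <ᵇ d)
<ᵇ-cong {a} {b} {c} {d} h = T-⇔⇒≡ (mk⇔ (<⇒<ᵇ ∘ to h ∘ <ᵇ⇒< a b) (<⇒<ᵇ ∘ from h ∘ <ᵇ⇒< c d))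

Before : Column → Column → Set
Before (a , b) (c , d) = a < c ⊎ (a ≡ c × d ≤ b)

beforeᵇ⇒Before : ∀ p q → beforeᵇ p q ≡ true → Before p q
beforeᵇ⇒Before (a , b) (c , d) e with to T-∨ (from T-≡ e)
... | inj₁ a<c = inj₁ (<ᵇ⇒< a c a<c)
... | inj₂ a≡c∧d≤b = inj₂ (≡ᵇ⇒≡ a c (proj₁ (to T-∧ a≡c∧d≤b)) , ≤ᵇ⇒≤ d b (proj₂ (to T-∧ a≡c∧d≤b)))

Before⇒beforeᵇ : ∀ p q → Before p q → beforeᵇ p q ≡ true
Before⇒beforeᵇ (a , b) (c , d) (inj₁ a<c) = to T-≡ (from T-∨ (inj₁ (<⇒<ᵇ a<c)))
Before⇒beforeᵇ (a , b) (c , d) (inj₂ (a≡c , d≤b)) =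
  to T-≡ (from T-∨ (inj₂ (from T-∧ (≡⇒≡ᵇ a c a≡c , ≤⇒≤ᵇ d≤b))))

Before-trans : ∀ {p q r} → Before p q → Before q r → Before p r
Before-trans (inj₁ a<c) (inj₁ c<e) = inj₁ (<-trans a<c c<e)
Before-trans (inj₁ a<c) (inj₂ (refl , _)) = inj₁ a<c
Before-trans (inj₂ (refl , _)) (inj₁ c<e) = inj₁ c<e
Before-trans (inj₂ (refl , d≤b)) (inj₂ (refl , f≤d)) = inj₂ (refl , ≤-trans f≤d d≤b)

Before-total : ∀ p q → ¬ Before p q → Before q p
Before-total (a , b) (c , d) ¬p<q with <-cmp a c
... | tri< a<c _ _ = ⊥-elim (¬p<q (inj₁ a<c))
... | tri≈ _ refl _ = inj₂ (refl , ≰⇒≥ (¬p<q ∘ inj₂ ∘ (refl ,_)))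
... | tri> _ _ c<a = inj₁ c<a

beforeᵇ-trans : ∀ p q r → beforeᵇ p q ≡ true → beforeᵇ q r ≡ true → beforeᵇ p r ≡ true
beforeᵇ-trans p q r p<q q<r =
  Before⇒beforeᵇ p r (Before-trans (beforeᵇ⇒Before p q p<q) (beforeᵇ⇒Before q r q<r))

beforeᵇ-flip : ∀ p q → beforeᵇ p q ≡ false → beforeᵇ q p ≡ true
beforeᵇ-flip p q p≮q = Before⇒beforeᵇ q p (Before-total p q λ p<q →
  contradiction (trans (sym (Before⇒beforeᵇ p q p<q)) p≮q) λ ())

beforeᵇ-later : ∀ {a v k j} → k < j → beforeᵇ (a , k) (v , j) ≡ (a <ᵇ v)
beforeᵇ-later {a} {v} {k} {j} k<j = begin
  (a <ᵇ v) ∨ ((a ≡ᵇ v) ∧ (j ≤ᵇ k))  ≡⟨ cong (λ t → (a <ᵇ v) ∨ ((a ≡ᵇ v) ∧ t)) (¬T⇒≡false (<⇒≱ k<j ∘ ≤ᵇ⇒≤ j k)) ⟩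
  (a <ᵇ v) ∨ ((a ≡ᵇ v) ∧ false)     ≡⟨ cong ((a <ᵇ v) ∨_) (∧-zeroʳ (a ≡ᵇ v)) ⟩
  (a <ᵇ v) ∨ false                  ≡⟨ ∨-identityʳ (a <ᵇ v) ⟩
  a <ᵇ v                            ∎
  where open ≡-Reasoning

insertCol-↭ : ∀ p L → insertCol p L ↭ p ∷ L
insertCol-↭ p [] = ↭-refl
insertCol-↭ p (q ∷ qs) with beforeᵇ p q
... | true  = ↭-refl
... | false = ↭-trans (↭-prep q (insertCol-↭ p qs)) (↭-swap q p ↭-refl)

sortCols-↭ : ∀ L → sortCols L ↭ L
sortCols-↭ [] = ↭-refl
sortCols-↭ (p ∷ ps) = ↭-trans (insertCol-↭ p (sortCols ps)) (↭-prep p (sortCols-↭ ps))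

Sorted : List Column → Set
Sorted = AllPairs (λ p q → beforeᵇ p q ≡ true)

insertCol-sorted : ∀ p L → Sorted L → Sorted (insertCol p L)
insertCol-sorted p [] [] = [] ∷ []
insertCol-sorted p (q ∷ qs) (q≤qs ∷ qs-sorted) with beforeᵇ p q in p<q
... | true  = (p<q ∷ All.map (λ {r} → beforeᵇ-trans p q r p<q) q≤qs) ∷ q≤qs ∷ qs-sorted
... | false = All-resp-↭ (↭-sym (insertCol-↭ p qs)) (beforeᵇ-flip p q p<q ∷ q≤qs)
            ∷ insertCol-sorted p qs qs-sorted

sortCols-sorted : ∀ L → Sorted (sortCols L)
sortCols-sorted [] = []
sortCols-sorted (p ∷ ps) = insertCol-sorted p (sortCols ps) (sortCols-sorted ps)

insertCol-split : ∀ c S → Sorted S → ∃[ S₁ ] ∃[ S₂ ]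
  S ≡ S₁ ++ S₂ × insertCol c S ≡ S₁ ++ c ∷ S₂ ×
  All (λ d → beforeᵇ c d ≡ false) S₁ × All (λ d → beforeᵇ c d ≡ true) S₂
insertCol-split c [] [] = [] , [] , refl , refl , [] , []
insertCol-split c (q ∷ qs) (q≤qs ∷ qs-sorted) with beforeᵇ c q in c<q
... | true = [] , q ∷ qs , refl , refl , [] , c<q ∷ All.map (λ {r} → beforeᵇ-trans c q r c<q) q≤qs
... | false with insertCol-split c qs qs-sorted
...   | S₁ , S₂ , qs≡ , ins≡ , S₁≮ , S₂> =
        q ∷ S₁ , S₂ , cong (q ∷_) qs≡ , cong (q ∷_) ins≡ , c<q ∷ S₁≮ , S₂>

++-∷-injective : ∀ {A : Set} {k : A} P₁ {P₂} Q₁ {Q₂} → k ∉ P₁ → k ∉ Q₁ →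
  P₁ ++ k ∷ P₂ ≡ Q₁ ++ k ∷ Q₂ → P₁ ≡ Q₁ × P₂ ≡ Q₂
++-∷-injective [] [] _ _ eq = refl , proj₂ (∷-injective eq)
++-∷-injective [] (q ∷ Q₁) _ k∉Q eq = ⊥-elim (k∉Q (here (proj₁ (∷-injective eq))))
++-∷-injective (p ∷ P₁) [] k∉P _ eq = ⊥-elim (k∉P (here (sym (proj₁ (∷-injective eq)))))
++-∷-injective (p ∷ P₁) (q ∷ Q₁) k∉P k∉Q eq with ∷-injective eq
... | refl , eq′ with ++-∷-injective P₁ Q₁ (k∉P ∘ there) (k∉Q ∘ there) eq′
...   | refl , P₂≡Q₂ = refl , P₂≡Q₂

-- γ with positions numbered from k

indexed : ℕ → Word → List (ℕ × ℕ)
indexed k [] = []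
indexed k (a ∷ x) = (k , a) ∷ indexed (suc k) x

columnsFrom : ℕ → Word → List Column
columnsFrom k x = sortCols (map swap (indexed k x))

γFrom : ℕ → Word → Word
γFrom k x = map proj₂ (columnsFrom k x)

zip-applyUpTo : ∀ (f : ℕ → ℕ) k x → (∀ i → f i ≡ k + i) → zip (applyUpTo f (length x)) x ≡ indexed k x
zip-applyUpTo f k [] _ = refl
zip-applyUpTo f k (a ∷ x) f≗k+ = cong₂ _∷_
  (cong (_, a) (trans (f≗k+ 0) (+-identityʳ k)))
  (zip-applyUpTo (f ∘ suc) (suc k) x (λ i → trans (f≗k+ (suc i)) (+-suc k i)))

γ≡γFrom : ∀ x → γ x ≡ γFrom 1 x
γ≡γFrom x = cong (λ l → map proj₂ (sortCols (map swap l)))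
  (trans (cong (λ t → zip t x) (map-applyUpTo id suc (length x))) (zip-applyUpTo suc 1 x λ _ → refl))

indexed-≥ : ∀ {k j v} x → (j , v) ∈ indexed k x → k ≤ j
indexed-≥ (a ∷ x) (here refl) = ≤-refl
indexed-≥ (a ∷ x) (there m) = ≤-trans (n≤1+n _) (indexed-≥ x m)

indexed-zip : ∀ {k j v w} x y → length x ≡ length y →
  (j , v) ∈ indexed k x → (j , w) ∈ indexed k y → (v , w) ∈ zip x y
indexed-zip (a ∷ x) (b ∷ y) _ (here refl) (here refl) = here refl
indexed-zip (a ∷ x) (b ∷ y) _ (here refl) (there m) = contradiction (indexed-≥ y m) (<-irrefl refl)
indexed-zip (a ∷ x) (b ∷ y) _ (there m) (here refl) = contradiction (indexed-≥ x m) (<-irrefl refl)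
indexed-zip (a ∷ x) (b ∷ y) eq (there m) (there m′) = there (indexed-zip x y (suc-injective eq) m m′)

∈-zip-diag : ∀ {A : Set} {v w : A} (x : List A) → (v , w) ∈ zip x x → v ≡ w
∈-zip-diag (a ∷ x) (here refl) = refl
∈-zip-diag (a ∷ x) (there m) = ∈-zip-diag x m

indexed-functional : ∀ {k j v w} x → (j , v) ∈ indexed k x → (j , w) ∈ indexed k x → v ≡ w
indexed-functional x m m′ = ∈-zip-diag x (indexed-zip x x refl m m′)

zip-indexed : ∀ {k v w} x y → (v , w) ∈ zip x y → ∃[ j ] (j , v) ∈ indexed k x × (j , w) ∈ indexed k y
zip-indexed {k} (a ∷ x) (b ∷ y) (here refl) = k , here refl , here refl
zip-indexed {k} (a ∷ x) (b ∷ y) (there m) with zip-indexed {suc k} x y m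
... | j , m₁ , m₂ = j , there m₁ , there m₂

∈-columnsFrom⁻ : ∀ {k v j} x → (v , j) ∈ columnsFrom k x → (j , v) ∈ indexed k x
∈-columnsFrom⁻ {k} x m with ∈-map⁻ swap (∈-resp-↭ (sortCols-↭ (map swap (indexed k x))) m)
... | (j , v) , m′ , refl = m′

∈-columnsFrom⁺ : ∀ {k v j} x → (j , v) ∈ indexed k x → (v , j) ∈ columnsFrom k x
∈-columnsFrom⁺ {k} x m = ∈-resp-↭ (↭-sym (sortCols-↭ (map swap (indexed k x)))) (∈-map⁺ swap m)

length-γ : ∀ x → length (γ x) ≡ length x
length-γ x = begin
  length (γ x)                        ≡⟨ cong length (γ≡γFrom x) ⟩
  length (γFrom 1 x)                  ≡⟨ length-map proj₂ (columnsFrom 1 x) ⟩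
  length (columnsFrom 1 x)            ≡⟨ ↭-length (sortCols-↭ (map swap (indexed 1 x))) ⟩
  length (map swap (indexed 1 x))     ≡⟨ length-map swap (indexed 1 x) ⟩
  length (indexed 1 x)                ≡⟨ length-indexed 1 x ⟩
  length x                            ∎
  where
  open ≡-Reasoning
  length-indexed : ∀ k x → length (indexed k x) ≡ length x
  length-indexed k [] = refl
  length-indexed k (a ∷ x) = cong suc (length-indexed (suc k) x)

-- γ determines exactly the rises

RiseAlike : Column → Column → Set
RiseAlike (a , b) (v , w) = (a <ᵇ v) ≡ (b <ᵇ w)

-- AllPairs over the aligned word zip x y ranges over the pairs of positions i < j.
record SameRises (x y : Word) : Set where
  constructor sameRises
  field
    length≡ : length x ≡ length y
    rises   : AllPairs RiseAlike (zip x y)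

insertCol-bottoms-cong : ∀ {a b k} (S T : List Column) → map proj₂ S ≡ map proj₂ T →
  (∀ {v j w} → (v , j) ∈ S → (w , j) ∈ T → beforeᵇ (a , k) (v , j) ≡ beforeᵇ (b , k) (w , j)) →
  map proj₂ (insertCol (a , k) S) ≡ map proj₂ (insertCol (b , k) T)
insertCol-bottoms-cong [] [] _ _ = refl
insertCol-bottoms-cong {a} {b} {k} ((v , j) ∷ S) ((w , j′) ∷ T) eq agree with ∷-injective eq
... | refl , eq′ with beforeᵇ (a , k) (v , j) | beforeᵇ (b , k) (w , j) | agree (here refl) (here refl)
...   | true  | true  | _ = cong (λ l → k ∷ j ∷ l) eq′
...   | false | false | _ = cong (j ∷_) (insertCol-bottoms-cong S T eq′ (λ m m′ → agree (there m) (there m′)))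

γFrom-cong : ∀ k {x y} → SameRises x y → γFrom k x ≡ γFrom k y
γFrom-cong k {[]} {[]} _ = refl
γFrom-cong k {a ∷ x} {b ∷ y} (sameRises |x|≡|y| (a-rises ∷ rises)) =
  insertCol-bottoms-cong (columnsFrom (suc k) x) (columnsFrom (suc k) y)
    (γFrom-cong (suc k) (sameRises (suc-injective |x|≡|y|) rises)) agree
  where
  agree : ∀ {v j w} → (v , j) ∈ columnsFrom (suc k) x → (w , j) ∈ columnsFrom (suc k) y →
          beforeᵇ (a , k) (v , j) ≡ beforeᵇ (b , k) (w , j)
  agree {v} {j} {w} m m′ = begin
    beforeᵇ (a , k) (v , j)  ≡⟨ beforeᵇ-later {a} {v} k<j ⟩
    a <ᵇ v                   ≡⟨ All.lookup a-rises (indexed-zip x y (suc-injective |x|≡|y|) mx my) ⟩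
    b <ᵇ w                   ≡⟨ sym (beforeᵇ-later {b} {w} k<j) ⟩
    beforeᵇ (b , k) (w , j)  ∎
    where
    open ≡-Reasoning
    mx = ∈-columnsFrom⁻ x m
    my = ∈-columnsFrom⁻ y m′
    k<j = indexed-≥ x mx

beforeᵇ-transfer : ∀ {c d β v w j} {U V : List Column} →
  All (λ e → beforeᵇ c e ≡ β) U → All (λ e → beforeᵇ d e ≡ β) V → map proj₂ U ≡ map proj₂ V →
  (∀ {w′} → (w′ , j) ∈ V → w′ ≡ w) → (v , j) ∈ U → beforeᵇ c (v , j) ≡ beforeᵇ d (w , j)
beforeᵇ-transfer U-β V-β U≡V unique m with ∈-map⁻ proj₂ (subst (_ ∈_) U≡V (∈-map⁺ proj₂ m))
... | (w′ , _) , m′ , refl with unique m′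
...   | refl = trans (All.lookup U-β m) (sym (All.lookup V-β m′))

∉-bottoms-columnsFrom : ∀ {k} z {U₁ U₂} → columnsFrom (suc k) z ≡ U₁ ++ U₂ → k ∉ map proj₂ U₁
∉-bottoms-columnsFrom z cols≡ k∈ with ∈-map⁻ proj₂ k∈
... | (v , _) , m , refl =
  <-irrefl refl (indexed-≥ z (∈-columnsFrom⁻ z (subst (_ ∈_) (sym cols≡) (∈-++⁺ˡ m))))

γFrom-rises : ∀ k x y → length x ≡ length y → γFrom k x ≡ γFrom k y → AllPairs RiseAlike (zip x y)
γFrom-rises k [] [] _ _ = []
γFrom-rises k (a ∷ x) (b ∷ y) |x|≡|y| eq
  with insertCol-split (a , k) (columnsFrom (suc k) x) (sortCols-sorted (map swap (indexed (suc k) x)))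
     | insertCol-split (b , k) (columnsFrom (suc k) y) (sortCols-sorted (map swap (indexed (suc k) y)))
... | S₁ , S₂ , S≡ , insS≡ , S₁≮ , S₂> | T₁ , T₂ , T≡ , insT≡ , T₁≮ , T₂> =
  All.tabulate head ∷ γFrom-rises (suc k) x y (suc-injective |x|≡|y|) tail
  where
  open ≡-Reasoning
  bottoms : map proj₂ S₁ ≡ map proj₂ T₁ × map proj₂ S₂ ≡ map proj₂ T₂
  bottoms = ++-∷-injective (map proj₂ S₁) (map proj₂ T₁)
    (∉-bottoms-columnsFrom x S≡) (∉-bottoms-columnsFrom y T≡) (begin
      map proj₂ S₁ ++ k ∷ map proj₂ S₂  ≡⟨ map-++ proj₂ S₁ _ ⟨
      map proj₂ (S₁ ++ (a , k) ∷ S₂)     ≡⟨ cong (map proj₂) insS≡ ⟨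
      γFrom k (a ∷ x)                   ≡⟨ eq ⟩
      γFrom k (b ∷ y)                   ≡⟨ cong (map proj₂) insT≡ ⟩
      map proj₂ (T₁ ++ (b , k) ∷ T₂)     ≡⟨ map-++ proj₂ T₁ _ ⟩
      map proj₂ T₁ ++ k ∷ map proj₂ T₂  ∎)
  tail : γFrom (suc k) x ≡ γFrom (suc k) y
  tail = begin
    γFrom (suc k) x                   ≡⟨ cong (map proj₂) S≡ ⟩
    map proj₂ (S₁ ++ S₂)              ≡⟨ map-++ proj₂ S₁ S₂ ⟩
    map proj₂ S₁ ++ map proj₂ S₂      ≡⟨ cong₂ _++_ (proj₁ bottoms) (proj₂ bottoms) ⟩
    map proj₂ T₁ ++ map proj₂ T₂      ≡⟨ map-++ proj₂ T₁ T₂ ⟨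
    map proj₂ (T₁ ++ T₂)              ≡⟨ cong (map proj₂) T≡ ⟨
    γFrom (suc k) y                   ∎
  head : ∀ {p} → p ∈ zip x y → RiseAlike (a , b) p
  head {v , w} m with zip-indexed {suc k} x y m
  ... | j , mx , my = begin
    a <ᵇ v                   ≡⟨ beforeᵇ-later {a} {v} (indexed-≥ x mx) ⟨
    beforeᵇ (a , k) (v , j)  ≡⟨ same-side (∈-++⁻ S₁ (subst ((v , j) ∈_) S≡ (∈-columnsFrom⁺ x mx))) ⟩
    beforeᵇ (b , k) (w , j)  ≡⟨ beforeᵇ-later {b} {w} (indexed-≥ y my) ⟩
    b <ᵇ w                   ∎
    where
    unique : ∀ {w′} → (w′ , j) ∈ T₁ ++ T₂ → w′ ≡ w
    unique m′ = indexed-functional y (∈-columnsFrom⁻ y (subst (_ ∈_) (sym T≡) m′)) my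
    same-side : (v , j) ∈ S₁ ⊎ (v , j) ∈ S₂ → beforeᵇ (a , k) (v , j) ≡ beforeᵇ (b , k) (w , j)
    same-side (inj₁ m₁) = beforeᵇ-transfer S₁≮ T₁≮ (proj₁ bottoms) (unique ∘ ∈-++⁺ˡ) m₁
    same-side (inj₂ m₂) = beforeᵇ-transfer S₂> T₂> (proj₂ bottoms) (unique ∘ ∈-++⁺ʳ T₁) m₂

SameRises⇒γ≡ : ∀ {x y} → SameRises x y → γ x ≡ γ y
SameRises⇒γ≡ {x} {y} rises = trans (γ≡γFrom x) (trans (γFrom-cong 1 rises) (sym (γ≡γFrom y)))

γ≡⇒length≡ : ∀ x y → γ x ≡ γ y → length x ≡ length y
γ≡⇒length≡ x y eq = trans (sym (length-γ x)) (trans (cong length eq) (length-γ y))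

γ≡⇒SameRises : ∀ x y → γ x ≡ γ y → SameRises x y
γ≡⇒SameRises x y eq = sameRises |x|≡|y|
  (γFrom-rises 1 x y |x|≡|y| (trans (sym (γ≡γFrom x)) (trans eq (γ≡γFrom y))))
  where
  |x|≡|y| : length x ≡ length y
  |x|≡|y| = γ≡⇒length≡ x y eq

Concordant : Column → Column → Set
Concordant (a , b) (a′ , b′) = (a < a′ ⇔ b < b′) × (a ≡ a′ ⇔ b ≡ b′)

record Similar (x y : Word) : Set where
  constructor similar
  field
    length≡    : length x ≡ length y
    concordant : ∀ {p q} → p ∈ zip x y → q ∈ zip x y → Concordant p q

zip-lookup : ∀ (x y : Word) (eq : length x ≡ length y) (i : Fin (length x)) →
  (lookup x i , lookup y (cast eq i)) ∈ zip x y
zip-lookup (a ∷ x) (b ∷ y) eq Fin.zero = here refl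
zip-lookup (a ∷ x) (b ∷ y) eq (Fin.suc i) = there (zip-lookup x y (suc-injective eq) i)

lookup-zip : ∀ (x y : Word) (eq : length x ≡ length y) {p} → p ∈ zip x y →
  ∃[ i ] p ≡ (lookup x i , lookup y (cast eq i))
lookup-zip (a ∷ x) (b ∷ y) eq (here refl) = Fin.zero , refl
lookup-zip (a ∷ x) (b ∷ y) eq (there m) with lookup-zip x y (suc-injective eq) m
... | i , refl = Fin.suc i , refl

OrderIso⇒Similar : ∀ {x y} → OrderIso x y → Similar x y
OrderIso⇒Similar {x} {y} (eq , iso) = similar eq concordant
  where
  concordant : ∀ {p q} → p ∈ zip x y → q ∈ zip x y → Concordant p q
  concordant m m′ with lookup-zip x y eq m | lookup-zip x y eq m′
  ... | i , refl | j , refl = iso i j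

Similar⇒OrderIso : ∀ {x y} → Similar x y → OrderIso x y
Similar⇒OrderIso {x} {y} (similar eq concordant) =
  eq , λ i j → concordant (zip-lookup x y eq i) (zip-lookup x y eq j)

Similar-refl : ∀ x → Similar x x
Similar-refl x = similar refl concordant
  where
  concordant : ∀ {p q} → p ∈ zip x x → q ∈ zip x x → Concordant p q
  concordant {v , _} {v′ , _} m m′ with ∈-zip-diag x m | ∈-zip-diag x m′
  ... | refl | refl = ⇔-id _ , ⇔-id _

∈-zip-swap : ∀ {A B : Set} {a : A} {b : B} (x : List A) (y : List B) → (a , b) ∈ zip x y → (b , a) ∈ zip y x
∈-zip-swap (c ∷ x) (d ∷ y) (here refl) = here refl
∈-zip-swap (c ∷ x) (d ∷ y) (there m) = there (∈-zip-swap x y m)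

Similar-sym : ∀ {x y} → Similar x y → Similar y x
Similar-sym {x} {y} (similar eq concordant) = similar (sym eq) λ m m′ →
  let (lt , eqv) = concordant (∈-zip-swap y x m) (∈-zip-swap y x m′) in ⇔-sym lt , ⇔-sym eqv

allPairs-∈ : ∀ {A : Set} {R : A → A → Set} {xs} → (∀ {p q} → p ∈ xs → q ∈ xs → R p q) → AllPairs R xs
allPairs-∈ {xs = []} _ = []
allPairs-∈ {xs = p ∷ xs} h = All.tabulate (h (here refl) ∘ there) ∷ allPairs-∈ (λ m m′ → h (there m) (there m′))

Similar⇒SameRises : ∀ {x y} → Similar x y → SameRises x y
Similar⇒SameRises (similar eq concordant) = sameRises eq (AllPairs.map (<ᵇ-cong ∘ proj₁) (allPairs-∈ concordant))

Similar⇒γ≡ : ∀ {x y} → Similar x y → γ x ≡ γ y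
Similar⇒γ≡ = SameRises⇒γ≡ ∘ Similar⇒SameRises

AllPairs-resp-⊆ : ∀ {A : Set} {R : A → A → Set} {xs ys} → xs ⊆ ys → AllPairs R ys → AllPairs R xs
AllPairs-resp-⊆ [] [] = []
AllPairs-resp-⊆ (_ ∷ʳ xs⊆ys) (_ ∷ rs) = AllPairs-resp-⊆ xs⊆ys rs
AllPairs-resp-⊆ (refl ∷ xs⊆ys) (r ∷ rs) = All-resp-⊆ xs⊆ys r ∷ AllPairs-resp-⊆ xs⊆ys rs

⊆-zip : ∀ {A B : Set} {zs ys : List A} {vs : List B} → zs ⊆ ys → length ys ≡ length vs →
  ∃[ us ] us ⊆ vs × length zs ≡ length us × zip zs us ⊆ zip ys vs
⊆-zip {vs = []} [] _ = [] , [] , refl , []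
⊆-zip {vs = b ∷ vs} (y ∷ʳ zs⊆ys) eq with ⊆-zip zs⊆ys (suc-injective eq)
... | us , us⊆vs , len , zip⊆ = us , b ∷ʳ us⊆vs , len , (y , b) ∷ʳ zip⊆
⊆-zip {vs = b ∷ vs} (refl ∷ zs⊆ys) eq with ⊆-zip zs⊆ys (suc-injective eq)
... | us , us⊆vs , len , zip⊆ = b ∷ us , refl ∷ us⊆vs , cong suc len , refl ∷ zip⊆

SameRises-restrict : ∀ {z u x y} → length z ≡ length u → zip z u ⊆ zip x y → SameRises x y → SameRises z u
SameRises-restrict len zip⊆ (sameRises _ rises) = sameRises len (AllPairs-resp-⊆ zip⊆ rises)

Similar-restrict : ∀ {z u x y} → length z ≡ length u → zip z u ⊆ zip x y → Similar x y → Similar z u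
Similar-restrict len zip⊆ (similar _ concordant) =
  similar len λ m m′ → concordant (Sublist.lookup zip⊆ m) (Sublist.lookup zip⊆ m′)

-- Standardisation

rank : Word → ℕ → ℕ
rank w zero = 0
rank w (suc t) with t ∈? w
... | yes _ = suc (rank w t)
... | no  _ = rank w t

rank-≤-suc : ∀ w t → rank w t ≤ rank w (suc t)
rank-≤-suc w t with t ∈? w
... | yes _ = n≤1+n _
... | no  _ = ≤-refl

rank-suc : ∀ w {t} → t ∈ w → rank w (suc t) ≡ suc (rank w t)
rank-suc w {t} t∈w with t ∈? w
... | yes _   = refl
... | no  t∉w = contradiction t∈w t∉w

rank-mono : ∀ w {t t′} → t ≤ t′ → rank w t ≤ rank w t′
rank-mono w = go ∘ ≤⇒≤′
  where
  go : ∀ {t t′} → t ≤′ t′ → rank w t ≤ rank w t′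
  go ≤′-refl = ≤-refl
  go (≤′-step t≤′t′) = ≤-trans (go t≤′t′) (rank-≤-suc w _)

rank-strict : ∀ w {t t′} → t ∈ w → t < t′ → rank w t < rank w t′
rank-strict w t∈w t<t′ = subst (_≤ _) (rank-suc w t∈w) (rank-mono w t<t′)

rank-onto : ∀ w t {u} → u < rank w t → ∃[ v ] v ∈ w × rank w v ≡ u
rank-onto w (suc t) {u} u< with t ∈? w
... | no  _ = rank-onto w t u<
... | yes t∈w with u <? rank w t
...   | yes u<′ = rank-onto w t u<′
...   | no  u≮  = t , t∈w , ≤-antisym (≮⇒≥ u≮) (≤-pred u<)

standardise : Word → Word
standardise w = map (suc ∘ rank w) w

maxW-∈ : ∀ z → 1 ≤ maxW z → maxW z ∈ z
maxW-∈ (a ∷ z) pos with ⊔-sel a (maxW z)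
... | inj₁ max≡a = here max≡a
... | inj₂ max≡z = there (subst (_∈ z) (sym max≡z) (maxW-∈ z (subst (1 ≤_) max≡z pos)))

standardise-Cayley : ∀ w → IsCayley (standardise w)
standardise-Cayley w = positive w , onto
  where
  positive : ∀ z → All (1 ≤_) (map (suc ∘ rank w) z)
  positive [] = []
  positive (_ ∷ z) = s≤s z≤n ∷ positive z
  onto : ∀ k → 1 ≤ k → k ≤ maxW (standardise w) → k ∈ standardise w
  onto (suc u) pos k≤max with ∈-map⁻ (suc ∘ rank w) (maxW-∈ (standardise w) (≤-trans pos k≤max))
  ... | v , v∈w , max≡ with rank-onto w (suc v) (subst (u <_) (sym (rank-suc w v∈w)) (subst (suc u ≤_) max≡ k≤max))
  ...   | v′ , v′∈w , refl = ∈-map⁺ (suc ∘ rank w) v′∈w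

Concordant-strictMono : ∀ {f : ℕ → ℕ} {v v′} → (v < v′ → f v < f v′) → (v′ < v → f v′ < f v) →
  Concordant (v , f v) (v′ , f v′)
Concordant-strictMono {v = v} {v′} mono mono′ with <-cmp v v′
... | tri< v<v′ v≢v′ _ =
  mk⇔ (const (mono v<v′)) (const v<v′) , mk⇔ (⊥-elim ∘ v≢v′) (λ eq → ⊥-elim (<-irrefl eq (mono v<v′)))
... | tri≈ _ refl _ =
  mk⇔ (⊥-elim ∘ <-irrefl refl) (⊥-elim ∘ <-irrefl refl) , mk⇔ (const refl) (const refl)
... | tri> v≮v′ v≢v′ v′<v =
  mk⇔ (⊥-elim ∘ v≮v′) (λ lt → ⊥-elim (<-asym lt (mono′ v′<v))) ,
  mk⇔ (⊥-elim ∘ v≢v′) (λ eq → ⊥-elim (<-irrefl (sym eq) (mono′ v′<v)))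

Similar-standardise : ∀ w → Similar w (standardise w)
Similar-standardise w = similar (sym (length-map (suc ∘ rank w) w)) concordant
  where
  ∈-zip-graph : ∀ {v r} z → (v , r) ∈ zip z (map (suc ∘ rank w) z) → v ∈ z × r ≡ suc (rank w v)
  ∈-zip-graph (_ ∷ z) (here refl) = here refl , refl
  ∈-zip-graph (_ ∷ z) (there m) with ∈-zip-graph z m
  ... | v∈z , refl = there v∈z , refl
  concordant : ∀ {p q} → p ∈ zip w (standardise w) → q ∈ zip w (standardise w) → Concordant p q
  concordant m m′ with ∈-zip-graph w m | ∈-zip-graph w m′
  ... | v∈w , refl | v′∈w , refl = Concordant-strictMono (s≤s ∘ rank-strict w v∈w) (s≤s ∘ rank-strict w v′∈w)

contains-through-γ : ∀ {x y y′ z} → Contains x y → γ y ≡ γ y′ → Contains y′ z →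
  ∃[ w ] w ⊆ x × γ w ≡ γ z
contains-through-γ {x} {y} {y′} {z} (z₁ , z₁⊆x , z₁≅y) γy≡γy′ (z₂ , z₂⊆y′ , z₂≅z)
  with ⊆-zip z₂⊆y′ (γ≡⇒length≡ y′ y (sym γy≡γy′))
... | u , u⊆y , |z₂|≡|u| , zip⊆ with Similar-sym (OrderIso⇒Similar {z₁} {y} z₁≅y)
...   | y≅z₁ with ⊆-zip u⊆y (Similar.length≡ y≅z₁)
...     | w , w⊆z₁ , |u|≡|w| , zip⊆′ = w , ⊆-trans w⊆z₁ z₁⊆x , (begin
  γ w   ≡⟨ Similar⇒γ≡ (Similar-restrict |u|≡|w| zip⊆′ y≅z₁) ⟨
  γ u   ≡⟨ SameRises⇒γ≡ (SameRises-restrict |z₂|≡|u| zip⊆ (γ≡⇒SameRises y′ y (sym γy≡γy′))) ⟨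
  γ z₂  ≡⟨ Similar⇒γ≡ (OrderIso⇒Similar {z₂} {z} z₂≅z) ⟩
  γ z   ∎)
  where open ≡-Reasoning

∼⇒≥ᶜ : ∀ {x y} → x ∼ y → x ≥ᶜ y
∼⇒≥ᶜ {x} {y} x∼y = x , x , refl , x∼y , proj₁ x , ⊆-refl , Similar⇒OrderIso (Similar-refl (proj₁ x))

≥ᶜ-trans : ∀ {x y z} → x ≥ᶜ y → y ≥ᶜ z → x ≥ᶜ z
≥ᶜ-trans (x′ , y′ , x′∼x , y′∼y , x′≥y′) (y″ , z′ , y″∼y , z′∼z , y″≥z′)
  with contains-through-γ {proj₁ x′} {proj₁ y′} {proj₁ y″} {proj₁ z′} x′≥y′ (trans y′∼y (sym y″∼y)) y″≥z′
... | w , w⊆x′ , γw≡γz′ =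
  x′ , (standardise w , standardise-Cayley w) , x′∼x ,
  trans (sym (Similar⇒γ≡ (Similar-standardise w))) (trans γw≡γz′ z′∼z) ,
  w , w⊆x′ , Similar⇒OrderIso (Similar-standardise w)

≥ᶜ-antisym : ∀ {x y} → x ≥ᶜ y → y ≥ᶜ x → x ∼ y
≥ᶜ-antisym (x′ , y′ , x′∼x , y′∼y , z₁ , z₁⊆x′ , z₁≅y′) (y″ , x″ , y″∼y , x″∼x , z₂ , z₂⊆y″ , z₂≅x″) =
  trans (sym x′∼x) (trans (Similar⇒γ≡ (subst (λ t → Similar t _) z₁≡x′ (OrderIso⇒Similar {z₁} {proj₁ y′} z₁≅y′))) y′∼y)
  where
  open ≤-Reasoning
  |x′|≤|z₁| : length (proj₁ x′) ≤ length z₁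
  |x′|≤|z₁| = begin
    length (proj₁ x′)  ≡⟨ γ≡⇒length≡ (proj₁ x′) (proj₁ x″) (trans x′∼x (sym x″∼x)) ⟩
    length (proj₁ x″)  ≡⟨ proj₁ z₂≅x″ ⟨
    length z₂          ≤⟨ length-mono-≤ z₂⊆y″ ⟩
    length (proj₁ y″)  ≡⟨ γ≡⇒length≡ (proj₁ y″) (proj₁ y′) (trans y″∼y (sym y′∼y)) ⟩
    length (proj₁ y′)  ≡⟨ proj₁ z₁≅y′ ⟨
    length z₁          ∎
  z₁≡x′ : z₁ ≡ proj₁ x′
  z₁≡x′ = ≋⇒≡ (to-≋ (≤-antisym (length-mono-≤ z₁⊆x′) |x′|≤|z₁|) z₁⊆x′)

mainTheorem9 : IsPartialOrder _∼_ _≥ᶜ_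
mainTheorem9 = record
  { isPreorder = record
    { isEquivalence = record { refl = refl ; sym = sym ; trans = trans }
    ; reflexive = λ {x} {y} → ∼⇒≥ᶜ {x} {y}
    ; trans = λ {x} {y} {z} → ≥ᶜ-trans {x} {y} {z}
    }
  ; antisym = λ {x} {y} → ≥ᶜ-antisym {x} {y}
  }
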